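{- Let $n \ge r$ be positive integers, let $k \ge r$ be an integer, and let $m = \binom{n}{r}/\binom{k}{r}$, assumed to be a positive integer. Then there is a partition of $\binom{[n]}{r}$ into $m$ cliques of size $k$ (i.e. there are $k$-element sets $A_1,\dots,A_m \subseteq [n]$ such that every $r$-subset of $[n]$ lies in exactly one $A_i$) if and only if $z(m,n,2,r) = km$.
   Context: $\binom{[n]}{r}$ is the family of $r$-subsets of $[n]=\{1,\dots,n\}$. The Zarankiewicz number $z(m,n,s,t)$ is the maximum number of edges in a bipartite graph with parts $A$, $B$ of sizes $m$, $n$ containing no complete bipartite subgraph with $s$ vertices in $A$ and $t$ vertices in $B$. -}

module Defs where

open import Data.Nat using (ℕ; _+_)
open import Data.Fin using (Fin)
open import Data.Fin.Subset using (Subset; ∣_∣; _∈_; _⊆_)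
open import Data.Vec using (tabulate; sum)
open import Data.Product using (Σ; _×_)
open import Relation.Binary.PropositionalEquality using (_≡_)
open import Relation.Nullary using (¬_)
open import Data.Nat using (_≤_)

-- A bipartite graph with parts A = Fin m and B = Fin n:
-- G a is the neighbourhood (subset of B) of vertex a ∈ A.
BipGraph : ℕ → ℕ → Set
BipGraph m n = Fin m → Subset n

edges : ∀ {m n} → BipGraph m n → ℕ
edges {m} G = sum (tabulate (λ a → ∣ G a ∣))

ContainsK : ∀ {m n} → ℕ → ℕ → BipGraph m n → Set
ContainsK {m} {n} s t G =
  Σ (Subset m) λ S → Σ (Subset n) λ T →
    (∣ S ∣ ≡ s) × (∣ T ∣ ≡ t) × (∀ a b → a ∈ S → b ∈ T → b ∈ G a)

IsZarankiewicz : ℕ → ℕ → ℕ → ℕ → ℕ → Set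
IsZarankiewicz m n s t z =
  (Σ (BipGraph m n) λ G → ¬ ContainsK s t G × edges G ≡ z)
  × (∀ (G : BipGraph m n) → ¬ ContainsK s t G → edges G ≤ z)

CliquePartition : ℕ → ℕ → ℕ → ℕ → Set
CliquePartition n r k m =
  Σ (Fin m → Subset n) λ A →
    (∀ i → ∣ A i ∣ ≡ k)
    × (∀ (S : Subset n) → ∣ S ∣ ≡ r →
         Σ (Fin m) λ i → (S ⊆ A i) × (∀ j → S ⊆ A j → j ≡ i))

-- A K₂,ᵣ-free bipartite graph is a packing: every r-subset of B lies in at most one
-- neighbourhood. Double counting r-subsets then gives Σₐ C(dₐ, r) ≤ C(n, r) = m C(k, r).
-- As x ↦ C(x, r) is convex it lies above its tangent at k, so Σₐ dₐ ≤ km; and for r ≥ 2,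
-- if Σₐ dₐ = km the tangent inequalities are all tight, which forces every dₐ = k. The double
-- count is then tight as well, i.e. every r-set lies in exactly one neighbourhood.
-- Conversely the cliques of a partition form a packing with km edges.

module Submission where

open import Defs
open import Data.Nat.Properties
import Algebra.Properties.Semiring.Sum as SemiringSum
open SemiringSum +-*-semiring using (sum-syntax; sum-cong-≗; ∑-distrib-+; *-distribʳ-sum)
open import Data.Bool.Base using (true; if_then_else_)
open import Data.Fin.Base using (Fin; zero; suc; splitAt)
open import Data.Fin.Properties using () renaming (_≟_ to _≟ᶠ_)
open import Data.Fin.Subset
  using (Subset; inside; outside; ⊤; ⊥; ∣_∣; _∈_; _⊆_; ⁅_⁆; _-_; Nonempty)
open import Data.Fin.Subset.Properties
open import Data.Nat.Base
  using (ℕ; zero; suc; _+_; _*_; _≤_; _<_; z≤n; s≤s; _≤′_; ≤′-refl; ≤′-step; >-nonZero)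
open import Data.Nat.Combinatorics using (_C_; nCk+nC[k+1]≡[n+1]C[k+1]; nC1≡n)
open import Data.Nat.Tactic.RingSolver using (solve-∀)
open import Data.Product using (Σ; ∃; _×_; _,_; proj₁)
open import Data.Sum using (inj₁; inj₂; [_,_]′)
open import Data.Vec.Base as Vec using ([]; _∷_; _++_; tabulate)
open import Data.Vec.Properties using (lookup∘tabulate; lookup⇒[]=; []=⇒lookup; lookup-splitAt)
open import Function.Base using (_∘_)
open import Function.Bundles using (_⇔_; mk⇔)
open import Relation.Binary.Core using (_Preserves_⟶_)
open import Relation.Binary.PropositionalEquality
open import Relation.Nullary using (Dec; yes; no; does; proof; ¬_; contradiction)
open import Relation.Nullary.Decidable using (dec-true)
open import Relation.Nullary.Reflects using (Reflects; invert)
open import Relation.Unary using (Pred; Decidable)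

𝟙[_] : ∀ {p} {P : Set p} → Dec P → ℕ
𝟙[ P? ] = if does P? then 1 else 0

𝟙-yes : ∀ {p} {P : Set p} (P? : Dec P) → P → 𝟙[ P? ] ≡ 1
𝟙-yes P? p = cong (if_then 1 else 0) (dec-true P? p)

sum-tabulate : ∀ {m} (f : Fin m → ℕ) → Vec.sum (tabulate f) ≡ ∑[ i < m ] f i
sum-tabulate {zero}  f = refl
sum-tabulate {suc m} f = cong (f zero +_) (sum-tabulate (f ∘ suc))

∑-const : ∀ m c → ∑[ i < m ] c ≡ m * c
∑-const zero    c = refl
∑-const (suc m) c = cong (c +_) (∑-const m c)

∑-mono-≤ : ∀ {m} {f g : Fin m → ℕ} → (∀ i → f i ≤ g i) → ∑[ i < m ] f i ≤ ∑[ i < m ] g i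
∑-mono-≤ {zero}  f≤g = z≤n
∑-mono-≤ {suc m} f≤g = +-mono-≤ (f≤g zero) (∑-mono-≤ (f≤g ∘ suc))

+-tight : ∀ {a b c d} → a ≤ b → c ≤ d → b + d ≤ a + c → a ≡ b × c ≡ d
+-tight {a} {b} {c} {d} a≤b c≤d b+d≤a+c =
  ≤-antisym a≤b (+-cancelʳ-≤ d b a (≤-trans b+d≤a+c (+-monoʳ-≤ a c≤d))) ,
  ≤-antisym c≤d (+-cancelˡ-≤ b d c (≤-trans b+d≤a+c (+-monoˡ-≤ c a≤b)))

∑-tight : ∀ {m} {f g : Fin m → ℕ} → (∀ i → f i ≤ g i) →
          ∑[ i < m ] g i ≤ ∑[ i < m ] f i → ∀ i → f i ≡ g i
∑-tight {suc m} f≤g ∑g≤∑f i with +-tight (f≤g zero) (∑-mono-≤ (f≤g ∘ suc)) ∑g≤∑f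
... | f₀≡g₀ , ∑f≡∑g with i
...   | zero   = f₀≡g₀
...   | suc i′ = ∑-tight (f≤g ∘ suc) (≤-reflexive (sym ∑f≡∑g)) i′

∑ˢ : ∀ n → (Subset n → ℕ) → ℕ
∑ˢ zero    f = f []
∑ˢ (suc n) f = ∑ˢ n (f ∘ (outside ∷_)) + ∑ˢ n (f ∘ (inside ∷_))

∑ˢ-zero : ∀ n → ∑ˢ n (λ _ → 0) ≡ 0
∑ˢ-zero zero    = refl
∑ˢ-zero (suc n) = cong₂ _+_ (∑ˢ-zero n) (∑ˢ-zero n)

∑ˢ-cong : ∀ n {f g : Subset n → ℕ} → (∀ T → f T ≡ g T) → ∑ˢ n f ≡ ∑ˢ n g
∑ˢ-cong zero    f≡g = f≡g []
∑ˢ-cong (suc n) f≡g = cong₂ _+_ (∑ˢ-cong n (f≡g ∘ (outside ∷_))) (∑ˢ-cong n (f≡g ∘ (inside ∷_)))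

∑ˢ-mono-≤ : ∀ n {f g : Subset n → ℕ} → (∀ T → f T ≤ g T) → ∑ˢ n f ≤ ∑ˢ n g
∑ˢ-mono-≤ zero    f≤g = f≤g []
∑ˢ-mono-≤ (suc n) f≤g = +-mono-≤ (∑ˢ-mono-≤ n (f≤g ∘ (outside ∷_))) (∑ˢ-mono-≤ n (f≤g ∘ (inside ∷_)))

∑ˢ-tight : ∀ n {f g : Subset n → ℕ} → (∀ T → f T ≤ g T) → ∑ˢ n g ≤ ∑ˢ n f → ∀ T → f T ≡ g T
∑ˢ-tight zero    f≤g ∑g≤∑f [] = ≤-antisym (f≤g []) ∑g≤∑f
∑ˢ-tight (suc n) f≤g ∑g≤∑f (x ∷ T)
  with +-tight (∑ˢ-mono-≤ n (f≤g ∘ (outside ∷_))) (∑ˢ-mono-≤ n (f≤g ∘ (inside ∷_))) ∑g≤∑f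
... | ∑out≡ , ∑in≡ with x
...   | outside = ∑ˢ-tight n (f≤g ∘ (outside ∷_)) (≤-reflexive (sym ∑out≡)) T
...   | inside  = ∑ˢ-tight n (f≤g ∘ (inside ∷_)) (≤-reflexive (sym ∑in≡)) T

∑ˢ-∑-comm : ∀ n {m} (h : Fin m → Subset n → ℕ) →
            ∑ˢ n (λ T → ∑[ a < m ] h a T) ≡ ∑[ a < m ] ∑ˢ n (h a)
∑ˢ-∑-comm zero    h = refl
∑ˢ-∑-comm (suc n) h =
  trans (cong₂ _+_ (∑ˢ-∑-comm n (λ a → h a ∘ (outside ∷_))) (∑ˢ-∑-comm n (λ a → h a ∘ (inside ∷_))))
        (sym (∑-distrib-+ (λ a → ∑ˢ n (h a ∘ (outside ∷_))) (λ a → ∑ˢ n (h a ∘ (inside ∷_)))))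

⟦_⟧ : ∀ {m p} {P : Pred (Fin m) p} → Decidable P → Subset m
⟦ P? ⟧ = tabulate (λ a → does (P? a))

module _ {m p} {P : Pred (Fin m) p} (P? : Decidable P) where

  ∈⟦⟧⁺ : ∀ {a} → P a → a ∈ ⟦ P? ⟧
  ∈⟦⟧⁺ {a} pa = lookup⇒[]= a _ (trans (lookup∘tabulate _ a) (dec-true (P? a) pa))

  ∈⟦⟧⁻ : ∀ {a} → a ∈ ⟦ P? ⟧ → P a
  ∈⟦⟧⁻ {a} a∈ = invert (subst (Reflects (P a)) does≡true (proof (P? a)))
    where
    does≡true : does (P? a) ≡ true
    does≡true = trans (sym (lookup∘tabulate _ a)) ([]=⇒lookup a∈)

∣⟦⟧∣≡∑𝟙 : ∀ {m p} {P : Pred (Fin m) p} (P? : Decidable P) → ∣ ⟦ P? ⟧ ∣ ≡ ∑[ a < m ] 𝟙[ P? a ]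
∣⟦⟧∣≡∑𝟙 {zero}  P? = refl
∣⟦⟧∣≡∑𝟙 {suc m} P? with P? zero
... | yes _ = cong suc (∣⟦⟧∣≡∑𝟙 (P? ∘ suc))
... | no  _ = ∣⟦⟧∣≡∑𝟙 (P? ∘ suc)

∣p∣≢0⇒Nonempty : ∀ {n} (p : Subset n) → ∣ p ∣ ≢ 0 → Nonempty p
∣p∣≢0⇒Nonempty {n} p ∣p∣≢0 with nonempty? p
... | yes p≠∅ = p≠∅
... | no  p=∅ = contradiction (trans (cong ∣_∣ (Empty-unique p=∅)) (∣⊥∣≡0 n)) ∣p∣≢0

unique⇒∣p∣≤1 : ∀ {n} {p : Subset n} → (∀ {i j} → i ∈ p → j ∈ p → i ≡ j) → ∣ p ∣ ≤ 1
unique⇒∣p∣≤1 {n} {p} unique with nonempty? p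
... | yes (i , i∈p) = subst (∣ p ∣ ≤_) (∣⁅x⁆∣≡1 i) (p⊆q⇒∣p∣≤∣q∣ p⊆⁅i⁆)
  where
  p⊆⁅i⁆ : p ⊆ ⁅ i ⁆
  p⊆⁅i⁆ j∈p = subst (_∈ ⁅ i ⁆) (unique i∈p j∈p) (x∈⁅x⁆ i)
... | no  p=∅ = subst (_≤ 1) (sym (trans (cong ∣_∣ (Empty-unique p=∅)) (∣⊥∣≡0 n))) z≤n

∣p∣≤1⇒unique : ∀ {n} {p : Subset n} → ∣ p ∣ ≤ 1 → ∀ {i j} → i ∈ p → j ∈ p → i ≡ j
∣p∣≤1⇒unique {p = p} ∣p∣≤1 {i} {j} i∈p j∈p with j ≟ᶠ i
... | yes j≡i = sym j≡i
... | no  j≢i = contradiction (≤-trans (s≤s 1≤∣p-i∣) (x∈p⇒∣p-x∣<∣p∣ i∈p)) (≤⇒≯ ∣p∣≤1)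
  where
  1≤∣p-i∣ : 1 ≤ ∣ p - i ∣
  1≤∣p-i∣ = ≤-trans (s≤s z≤n) (x∈p⇒∣p-x∣<∣p∣ (x∈p∧x≢y⇒x∈p-y j∈p j≢i))

⊆-of-size : ∀ {n} (p : Subset n) {j} → j ≤ ∣ p ∣ → ∃ λ q → q ⊆ p × ∣ q ∣ ≡ j
⊆-of-size []            z≤n = [] , (λ x∈[] → x∈[]) , refl
⊆-of-size (outside ∷ p) j≤∣p∣ with ⊆-of-size p j≤∣p∣
... | q , q⊆p , ∣q∣≡j = outside ∷ q , s⊆s q⊆p , ∣q∣≡j
⊆-of-size {suc n} (inside ∷ p) {zero} _ = ⊥ , ⊥⊆ , ∣⊥∣≡0 (suc n)
⊆-of-size (inside ∷ p) {suc j} (s≤s j≤∣p∣) with ⊆-of-size p j≤∣p∣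
... | q , q⊆p , ∣q∣≡j = inside ∷ q , s⊆s q⊆p , cong suc ∣q∣≡j

∣p++q∣≡∣p∣+∣q∣ : ∀ {k n} (p : Subset k) (q : Subset n) → ∣ p ++ q ∣ ≡ ∣ p ∣ + ∣ q ∣
∣p++q∣≡∣p∣+∣q∣ []            q = refl
∣p++q∣≡∣p∣+∣q∣ (outside ∷ p) q = ∣p++q∣≡∣p∣+∣q∣ p q
∣p++q∣≡∣p∣+∣q∣ (inside  ∷ p) q = cong suc (∣p++q∣≡∣p∣+∣q∣ p q)

∈-++⁻ : ∀ {k n} (p : Subset k) (q : Subset n) {x} → x ∈ p ++ q → [ _∈ p , _∈ q ]′ (splitAt k x)
∈-++⁻ {k} p q {x} x∈p++q with splitAt k x | lookup-splitAt k p q x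
... | inj₁ y | lookup≡ = lookup⇒[]= y p (trans (sym lookup≡) ([]=⇒lookup x∈p++q))
... | inj₂ z | lookup≡ = lookup⇒[]= z q (trans (sym lookup≡) ([]=⇒lookup x∈p++q))

[n+1]C[k+1]≡nC[k+1]+nCk : ∀ j s → suc j C suc s ≡ j C suc s + j C s
[n+1]C[k+1]≡nC[k+1]+nCk j s = trans (sym (nCk+nC[k+1]≡[n+1]C[k+1] j s)) (+-comm (j C s) (j C suc s))

k≤n⇒nCk>0 : ∀ {n s} → s ≤ n → 0 < n C s
k≤n⇒nCk>0 {n}     {zero}  _         = s≤s z≤n
k≤n⇒nCk>0 {suc n} {suc s} (s≤s s≤n) = subst (0 <_) (sym ([n+1]C[k+1]≡nC[k+1]+nCk n s)) (≤-trans (k≤n⇒nCk>0 s≤n) (m≤n+m _ _))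

nCk≤[n+1]Ck : ∀ j s → j C s ≤ suc j C s
nCk≤[n+1]Ck j zero    = ≤-refl
nCk≤[n+1]Ck j (suc s) = subst (j C suc s ≤_) (sym ([n+1]C[k+1]≡nC[k+1]+nCk j s)) (m≤m+n _ _)

k≤n⇒nC[k+1]<[n+1]C[k+1] : ∀ {j s} → s ≤ j → j C suc s < suc j C suc s
k≤n⇒nC[k+1]<[n+1]C[k+1] {j} {s} s≤j = subst (j C suc s <_) (sym ([n+1]C[k+1]≡nC[k+1]+nCk j s)) (m<m+n _ (k≤n⇒nCk>0 s≤j))

C-monoˡ-≤ : ∀ s → (_C s) Preserves _≤_ ⟶ _≤_
C-monoˡ-≤ s {i} i≤j = go (≤⇒≤′ i≤j)
  where
  go : ∀ {j} → i ≤′ j → i C s ≤ j C s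
  go ≤′-refl        = ≤-refl
  go (≤′-step i≤′j) = ≤-trans (go i≤′j) (nCk≤[n+1]Ck _ s)

count-t-subsets : ∀ {n} t (X : Subset n) → ∑ˢ n (λ T → 𝟙[ T ⊆? X ] * 𝟙[ ∣ T ∣ ≟ t ]) ≡ ∣ X ∣ C t
count-t-subsets {zero}  zero    [] = refl
count-t-subsets {zero}  (suc t) [] = refl
count-t-subsets {suc n} t (outside ∷ X) = trans (cong₂ _+_ (count-t-subsets t X) (∑ˢ-zero n)) (+-identityʳ _)
count-t-subsets {suc n} zero (inside ∷ X) =
  trans (cong₂ _+_ (count-t-subsets zero X) (trans (∑ˢ-cong n (λ T → *-zeroʳ 𝟙[ T ⊆? X ])) (∑ˢ-zero n)))
        (+-identityʳ _)
count-t-subsets {suc n} (suc t) (inside ∷ X) =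
  trans (cong₂ _+_ (count-t-subsets (suc t) X) (count-t-subsets t X)) (sym ([n+1]C[k+1]≡nC[k+1]+nCk ∣ X ∣ t))

count-t-subsets-⊤ : ∀ n t → ∑ˢ n (λ T → 𝟙[ ∣ T ∣ ≟ t ]) ≡ n C t
count-t-subsets-⊤ n t = begin
  ∑ˢ n (λ T → 𝟙[ ∣ T ∣ ≟ t ])              ≡⟨ ∑ˢ-cong n (λ T → trans (cong (_* 𝟙[ ∣ T ∣ ≟ t ]) (𝟙-yes (T ⊆? ⊤) ⊆⊤)) (*-identityˡ _)) ⟨
  ∑ˢ n (λ T → 𝟙[ T ⊆? ⊤ ] * 𝟙[ ∣ T ∣ ≟ t ]) ≡⟨ count-t-subsets t (⊤ {n}) ⟩
  ∣ ⊤ {n} ∣ C t                             ≡⟨ cong (_C t) (∣⊤∣≡n n) ⟩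
  n C t                                     ∎
  where open ≡-Reasoning

-- Convex sequences

module ConvexSequence (f g : ℕ → ℕ) (f-suc : ∀ j → f (suc j) ≡ f j + g j)
                      (g-mono : g Preserves _≤_ ⟶ _≤_) where

  private
    regroup : ∀ a s t x → a + t * x + s * x ≡ a + (s + t) * x
    regroup = solve-∀

    absorb : ∀ a t x → a + t * x + x ≡ a + suc t * x
    absorb = solve-∀

  secant-≤ : ∀ d t → f (d + t) ≤ f d + t * g (d + t)
  secant-≤ d zero    rewrite +-identityʳ d = m≤m+n (f d) 0
  secant-≤ d (suc t) rewrite +-suc d t = begin
    f (suc (d + t))                             ≡⟨ f-suc (d + t) ⟩
    f (d + t) + g (d + t)                       ≤⟨ +-monoˡ-≤ _ (secant-≤ d t) ⟩
    f d + t * g (d + t) + g (d + t)             ≤⟨ +-mono-≤ (+-monoʳ-≤ (f d) (*-monoʳ-≤ t step)) step ⟩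
    f d + t * g (suc (d + t)) + g (suc (d + t)) ≡⟨ absorb (f d) t _ ⟩
    f d + suc t * g (suc (d + t))               ∎
    where
    open ≤-Reasoning
    step = g-mono (n≤1+n (d + t))

  secant-< : ∀ d t → g (d + t) < g (suc (d + t)) → f (suc (d + t)) < f d + suc t * g (suc (d + t))
  secant-< d t g-step = begin-strict
    f (suc (d + t))                 ≡⟨ f-suc (d + t) ⟩
    f (d + t) + g (d + t)           ≤⟨ +-monoˡ-≤ _ (secant-≤ d t) ⟩
    f d + t * g (d + t) + g (d + t) ≡⟨ absorb (f d) t _ ⟩
    f d + suc t * g (d + t)         <⟨ +-monoʳ-< (f d) (*-monoʳ-< (suc t) g-step) ⟩
    f d + suc t * g (suc (d + t))   ∎
    where open ≤-Reasoning

  secant-≥ : ∀ k t → f k + t * g k ≤ f (k + t)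
  secant-≥ k zero    rewrite +-identityʳ k = ≤-reflexive (+-identityʳ (f k))
  secant-≥ k (suc t) rewrite +-suc k t = begin
    f k + suc t * g k     ≡⟨ absorb (f k) t (g k) ⟨
    f k + t * g k + g k   ≤⟨ +-mono-≤ (secant-≥ k t) (g-mono (m≤m+n k t)) ⟩
    f (k + t) + g (k + t) ≡⟨ f-suc (k + t) ⟨
    f (suc (k + t))       ∎
    where open ≤-Reasoning

  tangent-≤ : ∀ k d → f k + d * g k ≤ f d + k * g k
  tangent-≤ k d with ≤-total d k
  ... | inj₁ d≤k with m≤n⇒∃[o]m+o≡n d≤k
  ...   | t , refl = begin
    f (d + t) + d * g (d + t)           ≤⟨ +-monoˡ-≤ _ (secant-≤ d t) ⟩
    f d + t * g (d + t) + d * g (d + t) ≡⟨ regroup (f d) d t _ ⟩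
    f d + (d + t) * g (d + t)           ∎
    where open ≤-Reasoning
  tangent-≤ k d | inj₂ k≤d with m≤n⇒∃[o]m+o≡n k≤d
  ...   | t , refl = begin
    f k + (k + t) * g k       ≡⟨ regroup (f k) k t (g k) ⟨
    f k + t * g k + k * g k   ≤⟨ +-monoˡ-≤ _ (secant-≥ k t) ⟩
    f (k + t) + k * g k       ∎
    where open ≤-Reasoning

  tangent-< : ∀ j d → g j < g (suc j) → d ≤ j → f (suc j) + d * g (suc j) < f d + suc j * g (suc j)
  tangent-< j d g-step d≤j with m≤n⇒∃[o]m+o≡n d≤j
  ... | t , refl = begin-strict
    f (suc (d + t)) + d * G     <⟨ +-monoˡ-< _ (secant-< d t g-step) ⟩
    f d + suc t * G + d * G     ≡⟨ regroup (f d) d (suc t) G ⟩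
    f d + (d + suc t) * G       ≡⟨ cong (λ u → f d + u * G) (+-suc d t) ⟩
    f d + suc (d + t) * G       ∎
    where
    open ≤-Reasoning
    G = g (suc (d + t))

  module _ {m} (d : Fin m → ℕ) (k : ℕ) where

    private
      ∑-tangent : ∑[ a < m ] (f k + d a * g k) ≡ m * f k + (∑[ a < m ] d a) * g k
      ∑-tangent = trans (∑-distrib-+ (λ _ → f k) (λ a → d a * g k))
                        (cong₂ _+_ (∑-const m (f k)) (sym (*-distribʳ-sum (g k) d)))

      ∑-values : ∑[ a < m ] (f (d a) + k * g k) ≡ ∑[ a < m ] f (d a) + m * k * g k
      ∑-values = trans (∑-distrib-+ (λ a → f (d a)) (λ _ → k * g k))
                       (cong (∑[ a < m ] f (d a) +_) (trans (∑-const m (k * g k)) (sym (*-assoc m k (g k)))))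

      ∑-values-≤ : ∑[ a < m ] f (d a) ≤ m * f k →
                    ∑[ a < m ] (f (d a) + k * g k) ≤ m * f k + m * k * g k
      ∑-values-≤ ∑f≤ = ≤-trans (≤-reflexive ∑-values) (+-monoˡ-≤ (m * k * g k) ∑f≤)

    jensen-≤ : 0 < g k → ∑[ a < m ] f (d a) ≤ m * f k → ∑[ a < m ] d a ≤ m * k
    jensen-≤ 0<gk ∑f≤ = *-cancelʳ-≤ _ _ (g k) {{>-nonZero 0<gk}} (+-cancelˡ-≤ (m * f k) _ _ (begin
      m * f k + (∑[ a < m ] d a) * g k   ≡⟨ ∑-tangent ⟨
      ∑[ a < m ] (f k + d a * g k)       ≤⟨ ∑-mono-≤ (λ a → tangent-≤ k (d a)) ⟩
      ∑[ a < m ] (f (d a) + k * g k)     ≤⟨ ∑-values-≤ ∑f≤ ⟩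
      m * f k + m * k * g k              ∎))
      where open ≤-Reasoning

    -- The tangent at k, of slope g k, also passes through (suc k , f (suc k)), so tight tangent
    -- inequalities only exclude d a < k; the degree sum then excludes d a > k.
    jensen-≡ : ∀ {j} → k ≡ suc j → g j < g k → ∑[ a < m ] f (d a) ≤ m * f k →
               ∑[ a < m ] d a ≡ m * k → ∀ a → d a ≡ k
    jensen-≡ {j} refl g-step ∑f≤ ∑d≡mk a =
      sym (∑-tight k≤d (≤-reflexive (trans ∑d≡mk (sym (∑-const m k)))) a)
      where
      tangent-tight : ∀ a → f k + d a * g k ≡ f (d a) + k * g k
      tangent-tight = ∑-tight (λ a → tangent-≤ k (d a)) (begin
        ∑[ a < m ] (f (d a) + k * g k)     ≤⟨ ∑-values-≤ ∑f≤ ⟩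
        m * f k + m * k * g k              ≡⟨ cong (λ e → m * f k + e * g k) ∑d≡mk ⟨
        m * f k + (∑[ a < m ] d a) * g k   ≡⟨ ∑-tangent ⟨
        ∑[ a < m ] (f k + d a * g k)       ∎)
        where open ≤-Reasoning
      k≤d : ∀ a → k ≤ d a
      k≤d a with k ≤? d a
      ... | yes k≤da = k≤da
      ... | no  k≰da = contradiction (tangent-tight a) (<⇒≢ (tangent-< j (d a) g-step (≤-pred (≰⇒> k≰da))))

module BinomialConvexity (s : ℕ) = ConvexSequence (_C suc s) (_C s) (λ j → [n+1]C[k+1]≡nC[k+1]+nCk j s) (C-monoˡ-≤ s)

-- Packings

commonNeighbours : ∀ {m n} → BipGraph m n → Subset n → Subset m
commonNeighbours G T = ⟦ (λ a → T ⊆? G a) ⟧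

IsPacking : ∀ {m n} → ℕ → BipGraph m n → Set
IsPacking t G = ∀ T → ∣ T ∣ ≡ t → ∣ commonNeighbours G T ∣ ≤ 1

K₂-free⇒packing : ∀ {m n t} (G : BipGraph m n) → ¬ ContainsK 2 t G → IsPacking t G
K₂-free⇒packing G K₂-free T ∣T∣≡t with ∣ commonNeighbours G T ∣ ≤? 1
... | yes ≤1 = ≤1
... | no  ≰1 with ⊆-of-size (commonNeighbours G T) (≰⇒> ≰1)
...   | S , S⊆ , ∣S∣≡2 =
  contradiction (S , T , ∣S∣≡2 , ∣T∣≡t , λ a b a∈S b∈T → ∈⟦⟧⁻ (λ a → T ⊆? G a) (S⊆ a∈S) b∈T) K₂-free

packing⇒K₂-free : ∀ {m n t} (G : BipGraph m n) → IsPacking t G → ¬ ContainsK 2 t G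
packing⇒K₂-free G packing (S , T , ∣S∣≡2 , ∣T∣≡t , complete) =
  1+n≰n (subst (_≤ 1) ∣S∣≡2 (≤-trans (p⊆q⇒∣p∣≤∣q∣ S⊆) (packing T ∣T∣≡t)))
  where
  S⊆ : S ⊆ commonNeighbours G T
  S⊆ a∈S = ∈⟦⟧⁺ (λ a → T ⊆? G a) (complete _ _ a∈S)

partition⇒packing : ∀ {n t k m} (P : CliquePartition n t k m) → IsPacking t (proj₁ P)
partition⇒packing (A , _ , cover) T ∣T∣≡t = unique⇒∣p∣≤1 λ a∈ b∈ →
  let (_ , _ , only) = cover T ∣T∣≡t
  in trans (only _ (∈⟦⟧⁻ (λ a → T ⊆? A a) a∈)) (sym (only _ (∈⟦⟧⁻ (λ a → T ⊆? A a) b∈)))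

double-counting : ∀ {m n} t (G : BipGraph m n) →
  ∑[ a < m ] (∣ G a ∣ C t) ≡ ∑ˢ n (λ T → ∣ commonNeighbours G T ∣ * 𝟙[ ∣ T ∣ ≟ t ])
double-counting {m} {n} t G = begin
  ∑[ a < m ] (∣ G a ∣ C t)                                      ≡⟨ sum-cong-≗ (λ a → count-t-subsets t (G a)) ⟨
  ∑[ a < m ] ∑ˢ n (λ T → 𝟙[ T ⊆? G a ] * 𝟙[ ∣ T ∣ ≟ t ])        ≡⟨ ∑ˢ-∑-comm n (λ a T → 𝟙[ T ⊆? G a ] * 𝟙[ ∣ T ∣ ≟ t ]) ⟨
  ∑ˢ n (λ T → ∑[ a < m ] (𝟙[ T ⊆? G a ] * 𝟙[ ∣ T ∣ ≟ t ]))      ≡⟨ ∑ˢ-cong n (λ T → *-distribʳ-sum 𝟙[ ∣ T ∣ ≟ t ] (λ a → 𝟙[ T ⊆? G a ])) ⟨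
  ∑ˢ n (λ T → (∑[ a < m ] 𝟙[ T ⊆? G a ]) * 𝟙[ ∣ T ∣ ≟ t ])      ≡⟨ ∑ˢ-cong n (λ T → cong (_* _) (∣⟦⟧∣≡∑𝟙 (λ a → T ⊆? G a))) ⟨
  ∑ˢ n (λ T → ∣ commonNeighbours G T ∣ * 𝟙[ ∣ T ∣ ≟ t ])         ∎
  where open ≡-Reasoning

module _ {m n t} (G : BipGraph m n) (packing : IsPacking t G) where

  private
    weight-≤ : ∀ T → ∣ commonNeighbours G T ∣ * 𝟙[ ∣ T ∣ ≟ t ] ≤ 𝟙[ ∣ T ∣ ≟ t ]
    weight-≤ T = by-cases (∣ T ∣ ≟ t)
      where
      by-cases : (size? : Dec (∣ T ∣ ≡ t)) → ∣ commonNeighbours G T ∣ * 𝟙[ size? ] ≤ 𝟙[ size? ]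
      by-cases (yes ∣T∣≡t) = subst (_≤ 1) (sym (*-identityʳ _)) (packing T ∣T∣≡t)
      by-cases (no  _)     = ≤-reflexive (*-zeroʳ ∣ commonNeighbours G T ∣)

  packing-bound : ∑[ a < m ] (∣ G a ∣ C t) ≤ n C t
  packing-bound = begin
    ∑[ a < m ] (∣ G a ∣ C t)                                ≡⟨ double-counting t G ⟩
    ∑ˢ n (λ T → ∣ commonNeighbours G T ∣ * 𝟙[ ∣ T ∣ ≟ t ])  ≤⟨ ∑ˢ-mono-≤ n weight-≤ ⟩
    ∑ˢ n (λ T → 𝟙[ ∣ T ∣ ≟ t ])                             ≡⟨ count-t-subsets-⊤ n t ⟩
    n C t                                                   ∎
    where open ≤-Reasoning

  tight-packing⇒partition : ∀ {k} → (∀ a → ∣ G a ∣ ≡ k) → m * (k C t) ≡ n C t → CliquePartition n t k m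
  tight-packing⇒partition {k} ∣G∣≡k tight = G , ∣G∣≡k , unique-clique
    where
    saturated : ∀ T → ∣ commonNeighbours G T ∣ * 𝟙[ ∣ T ∣ ≟ t ] ≡ 𝟙[ ∣ T ∣ ≟ t ]
    saturated = ∑ˢ-tight n weight-≤ (≤-reflexive (begin
      ∑ˢ n (λ T → 𝟙[ ∣ T ∣ ≟ t ])                             ≡⟨ count-t-subsets-⊤ n t ⟩
      n C t                                                   ≡⟨ tight ⟨
      m * (k C t)                                             ≡⟨ ∑-const m (k C t) ⟨
      ∑[ a < m ] (k C t)                                      ≡⟨ sum-cong-≗ (λ a → cong (_C t) (∣G∣≡k a)) ⟨
      ∑[ a < m ] (∣ G a ∣ C t)                                ≡⟨ double-counting t G ⟩
      ∑ˢ n (λ T → ∣ commonNeighbours G T ∣ * 𝟙[ ∣ T ∣ ≟ t ])  ∎))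
      where open ≡-Reasoning

    covered : ∀ T → ∣ T ∣ ≡ t → ∣ commonNeighbours G T ∣ ≢ 0
    covered T ∣T∣≡t ∣cn∣≡0 = 0≢1+n (begin
      0                                          ≡⟨ cong (_* 𝟙[ ∣ T ∣ ≟ t ]) ∣cn∣≡0 ⟨
      ∣ commonNeighbours G T ∣ * 𝟙[ ∣ T ∣ ≟ t ]  ≡⟨ saturated T ⟩
      𝟙[ ∣ T ∣ ≟ t ]                             ≡⟨ 𝟙-yes (∣ T ∣ ≟ t) ∣T∣≡t ⟩
      1                                          ∎)
      where open ≡-Reasoning

    unique-clique : ∀ T → ∣ T ∣ ≡ t → Σ (Fin m) λ i → T ⊆ G i × (∀ j → T ⊆ G j → j ≡ i)
    unique-clique T ∣T∣≡t with ∣p∣≢0⇒Nonempty _ (covered T ∣T∣≡t)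
    ... | i , i∈ = i , ∈⟦⟧⁻ T⊆G? i∈ , λ j T⊆Gj → ∣p∣≤1⇒unique (packing T ∣T∣≡t) (∈⟦⟧⁺ T⊆G? T⊆Gj) i∈
      where T⊆G? = λ a → T ⊆? G a

-- Partition of [m k] into blocks

block : ∀ m k → Fin m → Subset (m * k)
block (suc m) k zero    = ⊤ {k} ++ ⊥ {m * k}
block (suc m) k (suc i) = ⊥ {k} ++ block m k i

∣block∣≡k : ∀ m k i → ∣ block m k i ∣ ≡ k
∣block∣≡k (suc m) k zero = begin
  ∣ ⊤ {k} ++ ⊥ {m * k} ∣ ≡⟨ ∣p++q∣≡∣p∣+∣q∣ (⊤ {k}) (⊥ {m * k}) ⟩
  ∣ ⊤ {k} ∣ + ∣ ⊥ {m * k} ∣ ≡⟨ cong₂ _+_ (∣⊤∣≡n k) (∣⊥∣≡0 (m * k)) ⟩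
  k + 0 ≡⟨ +-identityʳ k ⟩
  k ∎
  where open ≡-Reasoning
∣block∣≡k (suc m) k (suc i) = trans (∣p++q∣≡∣p∣+∣q∣ (⊥ {k}) (block m k i)) (cong₂ _+_ (∣⊥∣≡0 k) (∣block∣≡k m k i))

block-disjoint : ∀ m k {x} {i j : Fin m} → x ∈ block m k i → x ∈ block m k j → i ≡ j
block-disjoint (suc m) k {x} {zero}  {zero}  _    _    = refl
block-disjoint (suc m) k {x} {zero}  {suc j} x∈Bi x∈Bj
  with splitAt k x | ∈-++⁻ (⊤ {k}) (⊥ {m * k}) x∈Bi | ∈-++⁻ (⊥ {k}) (block m k j) x∈Bj
... | inj₁ _ | _   | y∈⊥ = contradiction y∈⊥ ∉⊥
... | inj₂ _ | z∈⊥ | _   = contradiction z∈⊥ ∉⊥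
block-disjoint (suc m) k {x} {suc i} {zero}  x∈Bi x∈Bj
  with splitAt k x | ∈-++⁻ (⊥ {k}) (block m k i) x∈Bi | ∈-++⁻ (⊤ {k}) (⊥ {m * k}) x∈Bj
... | inj₁ _ | y∈⊥ | _   = contradiction y∈⊥ ∉⊥
... | inj₂ _ | _   | z∈⊥ = contradiction z∈⊥ ∉⊥
block-disjoint (suc m) k {x} {suc i} {suc j} x∈Bi x∈Bj
  with splitAt k x | ∈-++⁻ (⊥ {k}) (block m k i) x∈Bi | ∈-++⁻ (⊥ {k}) (block m k j) x∈Bj
... | inj₁ _ | y∈⊥ | _   = contradiction y∈⊥ ∉⊥
... | inj₂ _ | z∈Bi | z∈Bj = cong suc (block-disjoint m k z∈Bi z∈Bj)

block-packing : ∀ m k → IsPacking 1 (block m k)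
block-packing m k T ∣T∣≡1 = unique⇒∣p∣≤1 λ i∈ j∈ →
  let (x , x∈T) = ∣p∣≢0⇒Nonempty T (λ ∣T∣≡0 → 1+n≢0 (trans (sym ∣T∣≡1) ∣T∣≡0))
  in block-disjoint m k (∈⟦⟧⁻ (λ a → T ⊆? block m k a) i∈ x∈T) (∈⟦⟧⁻ (λ a → T ⊆? block m k a) j∈ x∈T)

block-partition : ∀ m k → CliquePartition (m * k) 1 k m
block-partition m k = tight-packing⇒partition (block m k) (block-packing m k) (∣block∣≡k m k)
  (trans (cong (m *_) (nC1≡n k)) (sym (nC1≡n (m * k))))

-- Extremal graphs

edges≡∑ : ∀ {m n} (G : BipGraph m n) → edges G ≡ ∑[ a < m ] ∣ G a ∣
edges≡∑ G = sum-tabulate (λ a → ∣ G a ∣)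

edges-regular : ∀ {m n k} (G : BipGraph m n) → (∀ a → ∣ G a ∣ ≡ k) → edges G ≡ k * m
edges-regular {m} {k = k} G ∣G∣≡k =
  trans (edges≡∑ G) (trans (sum-cong-≗ ∣G∣≡k) (trans (∑-const m k) (*-comm m k)))

K₂-free⇒∑C≤ : ∀ {m n r k} → m * (k C r) ≡ n C r → (G : BipGraph m n) → ¬ ContainsK 2 r G →
              ∑[ a < m ] (∣ G a ∣ C r) ≤ m * (k C r)
K₂-free⇒∑C≤ tight G K₂-free =
  ≤-trans (packing-bound G (K₂-free⇒packing G K₂-free)) (≤-reflexive (sym tight))

K₂-free-edges-≤ : ∀ {m n r k} → 1 ≤ r → r ≤ k → m * (k C r) ≡ n C r →
                  (G : BipGraph m n) → ¬ ContainsK 2 r G → edges G ≤ k * m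
K₂-free-edges-≤ {m} {n} {suc s} {k} _ r≤k tight G K₂-free = begin
  edges G              ≡⟨ edges≡∑ G ⟩
  ∑[ a < m ] ∣ G a ∣   ≤⟨ BinomialConvexity.jensen-≤ s (λ a → ∣ G a ∣) k (k≤n⇒nCk>0 (<⇒≤ r≤k))
                            (K₂-free⇒∑C≤ {k = k} tight G K₂-free) ⟩
  m * k                ≡⟨ *-comm m k ⟩
  k * m                ∎
  where open ≤-Reasoning

extremal⇒partition : ∀ {m n r k} → 1 ≤ r → r ≤ k → m * (k C r) ≡ n C r → (G : BipGraph m n) →
                     ¬ ContainsK 2 r G → edges G ≡ k * m → CliquePartition n r k m
-- For r = 1 an extremal graph need not be regular, so the partition is built directly.
extremal⇒partition {m} {n} {1} {k} _ _ tight _ _ _ =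
  subst (λ n → CliquePartition n 1 k m) m*k≡n (block-partition m k)
  where m*k≡n = trans (cong (m *_) (sym (nC1≡n k))) (trans tight (nC1≡n n))
extremal⇒partition {m} {n} {suc (suc s)} {suc j} _ (s≤s 1+s≤j) tight G K₂-free edges≡ =
  tight-packing⇒partition G (K₂-free⇒packing G K₂-free) regular tight
  where
  regular = BinomialConvexity.jensen-≡ (suc s) (λ a → ∣ G a ∣) (suc j) refl
    (k≤n⇒nC[k+1]<[n+1]C[k+1] (<⇒≤ 1+s≤j)) (K₂-free⇒∑C≤ {k = suc j} tight G K₂-free)
    (trans (sym (edges≡∑ G)) (trans edges≡ (*-comm (suc j) m)))

partition⇒extremal : ∀ {m n r k} → 1 ≤ r → r ≤ k → m * (k C r) ≡ n C r →
                     CliquePartition n r k m → IsZarankiewicz m n 2 r (k * m)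
partition⇒extremal 1≤r r≤k tight P@(A , ∣A∣≡k , _) =
  (A , packing⇒K₂-free A (partition⇒packing P) , edges-regular A ∣A∣≡k) ,
  K₂-free-edges-≤ 1≤r r≤k tight

lemma9 : ∀ (n r k m : ℕ) → 1 ≤ r → r ≤ n → r ≤ k → 1 ≤ m →
           m * (k C r) ≡ n C r →
           CliquePartition n r k m ⇔ IsZarankiewicz m n 2 r (k * m)
lemma9 n r k m 1≤r _ r≤k _ tight = mk⇔
  (partition⇒extremal 1≤r r≤k tight)
  (λ ((G , K₂-free , edges≡km) , _) → extremal⇒partition 1≤r r≤k tight G K₂-free edges≡km)
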